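{- Let $G_1,G_2$ be unidirectional, edge-labeled Eulerian graphs and let $\mathcal{A}=(V\cup\{s,t\},E)$ be their modified alignment graph. Let $x\in\{0,1\}^{E}$ and $d\in\mathbb{N}^{E}$ satisfy: (i) for $i=1,2$ and every $f\in E_i$: $\sum_{e\in E,\ e\text{ not incident to } s \text{ or } t} x_e I_i(e,f)=1$; (ii) $\sum_{(s,u)\in E}x_{su}=1$ and $\sum_{(v,t)\in E}x_{vt}=1$; (iii) for every $v\in V$: $\sum_{(u,v)\in E}x_{uv}=\sum_{(v,w)\in E}x_{vw}$; (iv) for every $e\in E$, if $x_e=0$ then $d_e=0$; (v) for every $v\in V$: $\sum_{(v,w)\in E}d_{vw}-\sum_{(u,v)\in E}d_{uv}=\sum_{(v,w)\in E}x_{vw}$; (vi) $\sum_{(s,u)\in E}d_{su}=1$ and $\sum_{(v,t)\in E}d_{vt}=\sum_{e\in E}x_e$. Let $G'$ be the subgraph of $\mathcal{A}$ formed by the edges $e$ with $x_e=1$. Then $G'$ is connected and has a trail from $s$ to $t$ that traverses each edge of $G'$ exactly once.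
   Context: A unidirectional, edge-labeled Eulerian graph is a connected directed multigraph $G=(V,E,\ell,\Sigma)$ with edge multiset $E$, edge labels $\ell:E\to\Sigma$, having an Eulerian trail (traversing every edge exactly once; it may be open or closed), with all edges between the same pair of vertices pointing in the same direction. For $G_i=(V_i,E_i,\ell_i,\Sigma)$, $i=1,2$, the alignment graph has vertex set $V=V_1\times V_2$ and edge multiset consisting of: vertical edges $[(u_1,u_2),(v_1,u_2)]$ for each $(u_1,v_1)\in E_1$, $u_2\in V_2$; horizontal edges $[(u_1,u_2),(u_1,v_2)]$ for each $u_1\in V_1$, $(u_2,v_2)\in E_2$; diagonal edges $[(u_1,u_2),(v_1,v_2)]$ for each $(u_1,v_1)\in E_1$, $(u_2,v_2)\in E_2$. A vertical edge projects to its edge of $E_1$, a horizontal edge to its edge of $E_2$, a diagonal edge to its edge of $E_1$ and its edge of $E_2$; $I_i(e,f)=1$ if alignment edge $e$ projects to $f\in E_i$ and $0$ otherwise. The modified alignment graph adds a source vertex $s$ and sink vertex $t$: (a) if exactly one input graph, say $G_1$, has only open Eulerian trails, with start $a_1$ and end $b_1$, add edges $[s,(a_1,v_2)]$ and $[(b_1,v_2),t]$ for all $v_2\in V_2$; (b) if both have closed Eulerian trails, pick arbitrary $a_1\in V_1,a_2\in V_2$ and add $[s,(a_1,v_2)],[s,(v_1,a_2)],[(a_1,v_2),t],[(v_1,a_2),t]$ for all $v_1\in V_1,v_2\in V_2$; (c) if both have open Eulerian trails with start $a_i$ and end $b_i$ in $G_i$, add $[s,(a_1,a_2)]$ and $[(b_1,b_2),t]$.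 $E$ denotes the resulting edge multiset. -}

module Defs where

open import Data.Nat using (ℕ; _+_; _*_)
open import Data.Fin using (Fin)
open import Data.Fin.Properties renaming (_≟_ to _≟F_)
open import Data.List using (List; []; _∷_; map; length; _++_; concatMap)
open import Data.Nat.ListAction using (sum)
open import Data.List.Base using (allFin)
open import Data.List.Membership.Propositional using (_∈_)
open import Data.List.Relation.Unary.Unique.Propositional using (Unique)
open import Data.Bool using (Bool; true; false; if_then_else_; _∨_)
open import Data.Product using (Σ; Σ-syntax; ∃; ∃-syntax; _×_; _,_; proj₁; proj₂)
open import Data.Sum using (_⊎_)
open import Data.Unit using (⊤)
open import Relation.Nullary using (¬_; Dec; yes; no)
open import Relation.Nullary.Decidable using (⌊_⌋)
open import Relation.Binary.PropositionalEquality using (_≡_; refl; _≢_; cong)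
open import Function.Bundles using (_⇔_)

-- Generic notions for a directed multigraph given by src/tgt maps
-- (edges are the elements of E; parallel edges are distinct elements).

module Walk {V E : Set} (src tgt : E → V) where

  IsWalk : V → List E → V → Set
  IsWalk u []       v = u ≡ v
  IsWalk u (e ∷ es) v = (src e ≡ u) × IsWalk (tgt e) es v

  data UReach (P : E → Set) : V → V → Set where
    here : ∀ {u} → UReach P u u
    fwd  : ∀ {e v} → P e → UReach P (tgt e) v → UReach P (src e) v
    bwd  : ∀ {e v} → P e → UReach P (src e) v → UReach P (tgt e) v

  IsEulerTrail : V → List E → V → Set
  IsEulerTrail u es v = IsWalk u es v × Unique es × (∀ e → e ∈ es)

  IsCoveringTrail : (P : E → Set) → V → List E → V → Set
  IsCoveringTrail P u es v = IsWalk u es v × Unique es × (∀ e → (e ∈ es) ⇔ P e)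

record Graph (L : Set) : Set where
  field
    nV    : ℕ
    nE    : ℕ
    src   : Fin nE → Fin nV
    tgt   : Fin nE → Fin nV
    label : Fin nE → L

module _ {L : Set} (G : Graph L) where
  open Graph G
  open Walk src tgt

  Connected : Set
  Connected = ∀ (u v : Fin nV) → UReach (λ _ → ⊤) u v

  -- edges between the same pair of vertices point in the same direction
  Unidirectional : Set
  Unidirectional = ∀ (e e' : Fin nE) → src e ≡ tgt e' → tgt e ≡ src e' → src e ≡ tgt e

  HasEulerTrail : Fin nV → Fin nV → Set
  HasEulerTrail a b = Σ[ es ∈ List (Fin nE) ] IsEulerTrail a es b

  HasClosedEulerTrail : Set
  HasClosedEulerTrail = Σ[ v ∈ Fin nV ] HasEulerTrail v v

  OnlyOpen : Fin nV → Fin nV → Set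
  OnlyOpen a b = HasEulerTrail a b × ¬ HasClosedEulerTrail

  IsUEGraph : Set
  IsUEGraph = Connected × Unidirectional × (Σ[ a ∈ Fin nV ] Σ[ b ∈ Fin nV ] HasEulerTrail a b)

open Graph

-- The data needed to build the modified alignment graph: which case
-- (a) [G₁ open / G₂ open], (b), (c) applies, together with the vertices
-- a_i, b_i (in case (b) a₁, a₂ are arbitrary choices).
data Config {L : Set} (G₁ G₂ : Graph L) : Set where
  caseA₁ : (a₁ b₁ : Fin (nV G₁)) → OnlyOpen G₁ a₁ b₁ → HasClosedEulerTrail G₂ → Config G₁ G₂
  caseA₂ : (a₂ b₂ : Fin (nV G₂)) → HasClosedEulerTrail G₁ → OnlyOpen G₂ a₂ b₂ → Config G₁ G₂
  caseB  : HasClosedEulerTrail G₁ → HasClosedEulerTrail G₂ →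
           (a₁ : Fin (nV G₁)) (a₂ : Fin (nV G₂)) → Config G₁ G₂
  caseC  : (a₁ b₁ : Fin (nV G₁)) (a₂ b₂ : Fin (nV G₂)) →
           OnlyOpen G₁ a₁ b₁ → OnlyOpen G₂ a₂ b₂ → Config G₁ G₂

module _ {L : Set} {G₁ G₂ : Graph L} where

  -- heads (u with [s,u]) of the source edges, as a list (multiset)
  sHeads : Config G₁ G₂ → List (Fin (nV G₁) × Fin (nV G₂))
  sHeads (caseA₁ a₁ b₁ _ _) = map (λ v₂ → a₁ , v₂) (allFin (nV G₂))
  sHeads (caseA₂ a₂ b₂ _ _) = map (λ v₁ → v₁ , a₂) (allFin (nV G₁))
  sHeads (caseB _ _ a₁ a₂)  = map (λ v₂ → a₁ , v₂) (allFin (nV G₂))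
                              ++ map (λ v₁ → v₁ , a₂) (allFin (nV G₁))
  sHeads (caseC a₁ b₁ a₂ b₂ _ _) = (a₁ , a₂) ∷ []

  tTails : Config G₁ G₂ → List (Fin (nV G₁) × Fin (nV G₂))
  tTails (caseA₁ a₁ b₁ _ _) = map (λ v₂ → b₁ , v₂) (allFin (nV G₂))
  tTails (caseA₂ a₂ b₂ _ _) = map (λ v₁ → v₁ , b₂) (allFin (nV G₁))
  tTails (caseB _ _ a₁ a₂)  = map (λ v₂ → a₁ , v₂) (allFin (nV G₂))
                              ++ map (λ v₁ → v₁ , a₂) (allFin (nV G₁))
  tTails (caseC a₁ b₁ a₂ b₂ _ _) = (b₁ , b₂) ∷ []

  lookupL : ∀ {A : Set} (xs : List A) → Fin (length xs) → A
  lookupL = Data.List.lookup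

  data AVertex : Set where
    s t : AVertex
    ⟨_,_⟩ : Fin (nV G₁) → Fin (nV G₂) → AVertex

  _≟V_ : (u v : AVertex) → Dec (u ≡ v)
  s ≟V s = yes refl
  s ≟V t = no λ ()
  s ≟V ⟨ _ , _ ⟩ = no λ ()
  t ≟V s = no λ ()
  t ≟V t = yes refl
  t ≟V ⟨ _ , _ ⟩ = no λ ()
  ⟨ _ , _ ⟩ ≟V s = no λ ()
  ⟨ _ , _ ⟩ ≟V t = no λ ()
  ⟨ a , b ⟩ ≟V ⟨ a' , b' ⟩ with a ≟F a' | b ≟F b'
  ... | yes refl | yes refl = yes refl
  ... | no ne | _ = no λ { refl → ne refl }
  ... | yes _ | no ne = no λ { refl → ne refl }

  data AEdge (c : Config G₁ G₂) : Set where
    vert  : Fin (nE G₁) → Fin (nV G₂) → AEdge c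
    horiz : Fin (nV G₁) → Fin (nE G₂) → AEdge c
    diag  : Fin (nE G₁) → Fin (nE G₂) → AEdge c
    sEdge : Fin (length (sHeads c)) → AEdge c
    tEdge : Fin (length (tTails c)) → AEdge c

  module _ {c : Config G₁ G₂} where

    aSrc : AEdge c → AVertex
    aSrc (vert f u₂)  = ⟨ src G₁ f , u₂ ⟩
    aSrc (horiz u₁ g) = ⟨ u₁ , src G₂ g ⟩
    aSrc (diag f g)   = ⟨ src G₁ f , src G₂ g ⟩
    aSrc (sEdge i)    = s
    aSrc (tEdge i)    = ⟨ proj₁ (lookupL (tTails c) i) , proj₂ (lookupL (tTails c) i) ⟩

    aTgt : AEdge c → AVertex
    aTgt (vert f u₂)  = ⟨ tgt G₁ f , u₂ ⟩
    aTgt (horiz u₁ g) = ⟨ u₁ , tgt G₂ g ⟩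
    aTgt (diag f g)   = ⟨ tgt G₁ f , tgt G₂ g ⟩
    aTgt (sEdge i)    = ⟨ proj₁ (lookupL (sHeads c) i) , proj₂ (lookupL (sHeads c) i) ⟩
    aTgt (tEdge i)    = t

    allEdges : List (AEdge c)
    allEdges =
      concatMap (λ f → map (vert f) (allFin (nV G₂))) (allFin (nE G₁))
      ++ concatMap (λ u → map (horiz u) (allFin (nE G₂))) (allFin (nV G₁))
      ++ concatMap (λ f → map (diag f) (allFin (nE G₂))) (allFin (nE G₁))
      ++ map sEdge (allFin _)
      ++ map tEdge (allFin _)

    ΣE : (AEdge c → ℕ) → ℕ
    ΣE w = sum (map w allEdges)

    ΣOut : AVertex → (AEdge c → ℕ) → ℕ
    ΣOut v w = ΣE (λ e → if ⌊ aSrc e ≟V v ⌋ then w e else 0)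

    ΣIn : AVertex → (AEdge c → ℕ) → ℕ
    ΣIn v w = ΣE (λ e → if ⌊ aTgt e ≟V v ⌋ then w e else 0)

    isST : AVertex → Bool
    isST s = true
    isST t = true
    isST ⟨ _ , _ ⟩ = false

    touchesST : AEdge c → Bool
    touchesST e = isST (aSrc e) ∨ isST (aTgt e)

    I₁ : AEdge c → Fin (nE G₁) → ℕ
    I₁ (vert f' _) f = if ⌊ f' ≟F f ⌋ then 1 else 0
    I₁ (diag f' _) f = if ⌊ f' ≟F f ⌋ then 1 else 0
    I₁ _ _ = 0

    I₂ : AEdge c → Fin (nE G₂) → ℕ
    I₂ (horiz _ g') g = if ⌊ g' ≟F g ⌋ then 1 else 0
    I₂ (diag _ g') g = if ⌊ g' ≟F g ⌋ then 1 else 0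
    I₂ _ _ = 0

    -- x ∈ {0,1}^E as a Bool-valued function, read as a number
    val : (AEdge c → Bool) → AEdge c → ℕ
    val x e = if x e then 1 else 0

    Cond-i : (AEdge c → Bool) → Set
    Cond-i x =
      (∀ (f : Fin (nE G₁)) → ΣE (λ e → if touchesST e then 0 else val x e * I₁ e f) ≡ 1)
      × (∀ (f : Fin (nE G₂)) → ΣE (λ e → if touchesST e then 0 else val x e * I₂ e f) ≡ 1)

    Cond-ii : (AEdge c → Bool) → Set
    Cond-ii x = (ΣOut s (val x) ≡ 1) × (ΣIn t (val x) ≡ 1)

    Cond-iii : (AEdge c → Bool) → Set
    Cond-iii x = ∀ v₁ v₂ → ΣIn ⟨ v₁ , v₂ ⟩ (val x) ≡ ΣOut ⟨ v₁ , v₂ ⟩ (val x)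

    Cond-iv : (AEdge c → Bool) → (AEdge c → ℕ) → Set
    Cond-iv x d = ∀ e → x e ≡ false → d e ≡ 0

    -- (v) written additively: out_d − in_d = out_x  ⟺  out_d = in_d + out_x
    Cond-v : (AEdge c → Bool) → (AEdge c → ℕ) → Set
    Cond-v x d = ∀ v₁ v₂ →
      ΣOut ⟨ v₁ , v₂ ⟩ d ≡ ΣIn ⟨ v₁ , v₂ ⟩ d + ΣOut ⟨ v₁ , v₂ ⟩ (val x)

    Cond-vi : (AEdge c → Bool) → (AEdge c → ℕ) → Set
    Cond-vi x d = (ΣOut s d ≡ 1) × (ΣIn t d ≡ ΣE (val x))

    open Walk aSrc aTgt public

    InG' : (AEdge c → Bool) → AVertex → Set
    InG' x v = Σ[ e ∈ AEdge c ] (x e ≡ true) × ((aSrc e ≡ v) ⊎ (aTgt e ≡ v))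

    G'Connected : (AEdge c → Bool) → Set
    G'Connected x = ∀ u v → InG' x u → InG' x v → UReach (λ e → x e ≡ true) u v

    G'EulerST : (AEdge c → Bool) → Set
    G'EulerST x = Σ[ es ∈ List (AEdge c) ] IsCoveringTrail (λ e → x e ≡ true) s es t

module Submission where

-- By (ii) and (iii) the edges with x_e = 1 have the in- and out-degrees of an s–t trail, so
-- Hierholzer's construction (walk greedily from s, then splice in closed walks through visited
-- vertices) gives a trail T from s to t whose unused edges form a closed subgraph that no
-- vertex of T can leave. The flow d rules such leftover edges out: multiply (v) by the
-- indicator π of lying off T and sum over V. Since π vanishes at s and t and is constant along
-- every edge with d_e > 0 (such edges lie on T or among the leftovers), what remains is
-- Σ_e π(src e) x_e = 0, while a leftover edge would contribute 1. Hence T uses every edge of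
-- G' exactly once, and G' is connected because all its edges lie on T.

open import Data.Bool using (Bool; true; false; if_then_else_)
open import Data.Fin using (Fin)
import Data.Fin.Properties as Fin
open import Data.List using (List; []; _∷_; map; _++_; concatMap; allFin; cartesianProductWith; length)
open import Data.List.Properties using (map-cong; map-++)
open import Data.List.Membership.Propositional using (_∈_; _∉_; find)
open import Data.List.Membership.Propositional.Properties
  using (∈-allFin; ∈-map⁺; ∈-map⁻; ∈-++⁺ˡ; ∈-++⁺ʳ; ∈-++⁻; ∈-cartesianProductWith⁺; ∈-cartesianProductWith⁻)
open import Data.List.Relation.Binary.Disjoint.Propositional using (Disjoint)
import Data.List.Relation.Unary.All as All
open import Data.List.Relation.Unary.All.Properties using (¬Any⇒All¬)
open import Data.List.Relation.Unary.AllPairs using ([]; _∷_)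
open import Data.List.Relation.Unary.Any using (here; there; any?)
open import Data.List.Relation.Unary.Unique.Propositional using (Unique)
open import Data.List.Relation.Unary.Unique.Propositional.Properties
  using (++⁺; map⁺; allFin⁺; cartesianProductWith⁺)
open import Data.Nat using (ℕ; zero; suc; _+_; _*_; _≤_; _<_; z≤n; s≤s; z<s)
open import Data.Nat.Induction using (<-wellFounded)
open import Data.Nat.ListAction using (sum)
open import Data.Nat.ListAction.Properties using (sum-++)
open import Data.Nat.Properties
open import Algebra.Properties.CommutativeSemigroup +-commutativeSemigroup
  using (interchange; xy∙z≈xz∙y)
open import Data.Nat.Tactic.RingSolver using (solve-∀)
open import Data.Product using (Σ-syntax; _×_; _,_; proj₁; proj₂)
import Data.Product.Properties as Product
open import Data.Sum using (_⊎_; inj₁; inj₂; [_,_])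
import Data.Sum.Properties as Sum
open import Function.Bundles using (_⇔_; mk⇔; Equivalence)
open import Induction.WellFounded using (Acc; acc)
open import Relation.Binary.Definitions using (DecidableEquality)
open import Relation.Binary.PropositionalEquality hiding ([_])
open import Relation.Nullary using (¬_; yes; no; contradiction)
open import Relation.Nullary.Decidable using (⌊_⌋; map′)

open import Defs hiding (IsWalk; UReach; here; fwd; bwd; IsEulerTrail; IsCoveringTrail)

∑ : ∀ {A : Set} → List A → (A → ℕ) → ℕ
∑ xs f = sum (map f xs)

syntax ∑ xs (λ x → f) = ∑[ x ← xs ] f

module _ {A : Set} where

  ∑-cong : ∀ xs {f g : A → ℕ} → (∀ a → f a ≡ g a) → ∑ xs f ≡ ∑ xs g
  ∑-cong xs f≗g = cong sum (map-cong f≗g xs)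

  ∑-zero : ∀ xs {f : A → ℕ} → (∀ a → f a ≡ 0) → ∑ xs f ≡ 0
  ∑-zero []       f≗0 = refl
  ∑-zero (x ∷ xs) f≗0 = cong₂ _+_ (f≗0 x) (∑-zero xs f≗0)

  ∑-++ : ∀ xs ys (f : A → ℕ) → ∑ (xs ++ ys) f ≡ ∑ xs f + ∑ ys f
  ∑-++ xs ys f = trans (cong sum (map-++ f xs ys)) (sum-++ (map f xs) (map f ys))

  ∑-+ : ∀ xs (f g : A → ℕ) → ∑[ a ← xs ] (f a + g a) ≡ ∑ xs f + ∑ xs g
  ∑-+ []       f g = refl
  ∑-+ (x ∷ xs) f g = trans (cong (f x + g x +_) (∑-+ xs f g))
                          (interchange (f x) (g x) _ _)

  ∑-*ˡ : ∀ xs k (f : A → ℕ) → ∑[ a ← xs ] (k * f a) ≡ k * ∑ xs f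
  ∑-*ˡ []       k f = sym (*-zeroʳ k)
  ∑-*ˡ (x ∷ xs) k f = trans (cong (k * f x +_) (∑-*ˡ xs k f)) (sym (*-distribˡ-+ k (f x) _))

  ∑-mono-≤ : ∀ xs {f g : A → ℕ} → (∀ a → f a ≤ g a) → ∑ xs f ≤ ∑ xs g
  ∑-mono-≤ []       f≤g = z≤n
  ∑-mono-≤ (x ∷ xs) f≤g = +-mono-≤ (f≤g x) (∑-mono-≤ xs f≤g)

  ∈⇒≤∑ : ∀ {xs a} (f : A → ℕ) → a ∈ xs → f a ≤ ∑ xs f
  ∈⇒≤∑ f (here refl) = m≤m+n _ _
  ∈⇒≤∑ f (there a∈) = ≤-trans (∈⇒≤∑ f a∈) (m≤n+m _ _)

  ∑-mono-< : ∀ {xs a} {f g : A → ℕ} → (∀ b → f b ≤ g b) → a ∈ xs → f a < g a → ∑ xs f < ∑ xs g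
  ∑-mono-< {x ∷ xs} f≤g (here refl) lt = +-mono-<-≤ lt (∑-mono-≤ xs f≤g)
  ∑-mono-< f≤g (there a∈) lt = +-mono-≤-< (f≤g _) (∑-mono-< f≤g a∈ lt)

  ∑-pos : ∀ xs (f : A → ℕ) → 0 < ∑ xs f → Σ[ a ∈ A ] 0 < f a
  ∑-pos (x ∷ xs) f 0<∑ with f x in fx≡
  ... | zero  = ∑-pos xs f 0<∑
  ... | suc _ = x , subst (0 <_) (sym fx≡) z<s

∑-comm : ∀ {A B : Set} xs ys (f : A → B → ℕ) →
         ∑[ x ← xs ] ∑[ y ← ys ] f x y ≡ ∑[ y ← ys ] ∑[ x ← xs ] f x y
∑-comm []       ys f = sym (∑-zero ys λ _ → refl)
∑-comm (x ∷ xs) ys f =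
  trans (cong (∑ ys (f x) +_) (∑-comm xs ys f)) (sym (∑-+ ys (f x) _))

module Counting {A : Set} (_≟_ : DecidableEquality A) where

  count : A → List A → ℕ
  count a xs = ∑[ b ← xs ] (if ⌊ a ≟ b ⌋ then 1 else 0)

  IsEnumeration : List A → Set
  IsEnumeration xs = ∀ a → count a xs ≡ 1

  ≟-refl : ∀ a → ⌊ a ≟ a ⌋ ≡ true
  ≟-refl a with a ≟ a
  ... | yes _   = refl
  ... | no a≢a = contradiction refl a≢a

  ≟-≢ : ∀ {a b} → a ≢ b → ⌊ a ≟ b ⌋ ≡ false
  ≟-≢ {a} {b} a≢b with a ≟ b
  ... | yes a≡b = contradiction a≡b a≢b
  ... | no _    = refl

  ∑-sift : ∀ xs a (f : A → ℕ) → ∑[ b ← xs ] (if ⌊ a ≟ b ⌋ then f b else 0) ≡ count a xs * f a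
  ∑-sift xs a f = begin
    ∑[ b ← xs ] (if ⌊ a ≟ b ⌋ then f b else 0)   ≡⟨ ∑-cong xs pointwise ⟩
    ∑[ b ← xs ] (f a * (if ⌊ a ≟ b ⌋ then 1 else 0)) ≡⟨ ∑-*ˡ xs (f a) _ ⟩
    f a * count a xs                                ≡⟨ *-comm (f a) _ ⟩
    count a xs * f a                                ∎
    where
    open ≡-Reasoning
    pointwise : ∀ b → (if ⌊ a ≟ b ⌋ then f b else 0) ≡ f a * (if ⌊ a ≟ b ⌋ then 1 else 0)
    pointwise b with a ≟ b
    ... | yes refl = sym (*-identityʳ (f a))
    ... | no _     = sym (*-zeroʳ (f a))

  count-++ : ∀ a xs ys → count a (xs ++ ys) ≡ count a xs + count a ys
  count-++ a xs ys = ∑-++ xs ys _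

  ∉⇒count≡0 : ∀ {a xs} → a ∉ xs → count a xs ≡ 0
  ∉⇒count≡0 {a} {[]}     a∉ = refl
  ∉⇒count≡0 {a} {x ∷ xs} a∉ rewrite ≟-≢ (λ a≡x → a∉ (here a≡x)) =
    ∉⇒count≡0 (λ a∈ → a∉ (there a∈))

  ∈⇒0<count : ∀ {a xs} → a ∈ xs → 0 < count a xs
  ∈⇒0<count {a} {xs} a∈ = subst (λ n → n ≤ count a xs) (cong (if_then 1 else 0) (≟-refl a))
    (∈⇒≤∑ (λ b → if ⌊ a ≟ b ⌋ then 1 else 0) a∈)

  0<count⇒∈ : ∀ {a} xs → 0 < count a xs → a ∈ xs
  0<count⇒∈ {a} (x ∷ xs) 0<c with a ≟ x
  ... | yes a≡x = here a≡x
  ... | no _    = there (0<count⇒∈ xs 0<c)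

  unique⇒count≡1 : ∀ {a xs} → Unique xs → a ∈ xs → count a xs ≡ 1
  unique⇒count≡1 {a} (x∉xs ∷ _) (here refl)
    rewrite ≟-refl a = cong suc (∉⇒count≡0 (λ a∈ → All.lookup x∉xs a∈ refl))
  unique⇒count≡1 {a} (x∉xs ∷ xs!) (there a∈)
    rewrite ≟-≢ (λ a≡x → All.lookup x∉xs a∈ (sym a≡x)) = unique⇒count≡1 xs! a∈

  count≤1⇒unique : ∀ xs → (∀ a → count a xs ≤ 1) → Unique xs
  count≤1⇒unique []       _    = []
  count≤1⇒unique (x ∷ xs) c≤1 = All.tabulate x∉xs ∷ count≤1⇒unique xs (λ a → ≤-trans (m≤n+m _ _) (c≤1 a))
    where
    x∉xs : ∀ {y} → y ∈ xs → x ≢ y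
    x∉xs y∈ refl with c≤1 x
    ... | c≤1 rewrite ≟-refl x = <-irrefl refl (≤-trans (s≤s (∈⇒0<count y∈)) c≤1)

module Trails {V E : Set} (_≟V_ : DecidableEquality V) (_≟E_ : DecidableEquality E)
              (src tgt : E → V) (vertices : List V) (edges : List E)
              (vertices-enum : Counting.IsEnumeration _≟V_ vertices)
              (edges-enum : Counting.IsEnumeration _≟E_ edges) where

  open Walk src tgt
  open Counting _≟E_
  module Vertex = Counting _≟V_

  ∈-edges : ∀ e → e ∈ edges
  ∈-edges e = 0<count⇒∈ edges (subst (0 <_) (sym (edges-enum e)) z<s)

  EdgeSet : Set
  EdgeSet = E → Bool

  𝟙 : EdgeSet → E → ℕ
  𝟙 r e = if r e then 1 else 0

  𝟙≡1 : ∀ r {e} → r e ≡ true → 𝟙 r e ≡ 1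
  𝟙≡1 r = cong (if_then 1 else 0)

  Out In : V → (E → ℕ) → ℕ
  Out v w = ∑[ e ← edges ] (if ⌊ src e ≟V v ⌋ then w e else 0)
  In  v w = ∑[ e ← edges ] (if ⌊ tgt e ≟V v ⌋ then w e else 0)

  size : EdgeSet → ℕ
  size r = ∑ edges (𝟙 r)

  δ : V → V → ℕ
  δ u v = if ⌊ u ≟V v ⌋ then 1 else 0

  _-_ : EdgeSet → E → EdgeSet
  (r - e) e' = if ⌊ e ≟E e' ⌋ then false else r e'

  -- the degrees of the edge set of a trail from a to b
  Balanced : EdgeSet → V → V → Set
  Balanced r a b = ∀ v → Out v (𝟙 r) + δ b v ≡ In v (𝟙 r) + δ a v

  Closed : EdgeSet → Set
  Closed r = ∀ v → Out v (𝟙 r) ≡ In v (𝟙 r)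

  Decomposes : EdgeSet → List E → EdgeSet → Set
  Decomposes r P r' = ∀ e → count e P + 𝟙 r' e ≡ 𝟙 r e

  ∑-remove : ∀ r e → r e ≡ true → (p : E → Bool) →
             ∑[ b ← edges ] (if p b then 𝟙 r b else 0)
             ≡ ∑[ b ← edges ] (if p b then 𝟙 (r - e) b else 0) + (if p e then 1 else 0)
  ∑-remove r e re p = begin
    ∑ edges f                                        ≡⟨ ∑-cong edges split ⟩
    ∑[ b ← edges ] (f⁻ b + (if ⌊ e ≟E b ⌋ then f b else 0)) ≡⟨ ∑-+ edges _ _ ⟩
    ∑ edges f⁻ + ∑[ b ← edges ] (if ⌊ e ≟E b ⌋ then f b else 0)
      ≡⟨ cong (∑ edges f⁻ +_) (∑-sift edges e f) ⟩
    ∑ edges f⁻ + count e edges * f e                 ≡⟨ cong (λ n → ∑ edges f⁻ + n * f e) (edges-enum e) ⟩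
    ∑ edges f⁻ + (f e + 0)                           ≡⟨ cong (∑ edges f⁻ +_) (+-identityʳ (f e)) ⟩
    ∑ edges f⁻ + f e                                 ≡⟨ cong (λ n → ∑ edges f⁻ + (if p e then n else 0)) (𝟙≡1 r re) ⟩
    ∑ edges f⁻ + (if p e then 1 else 0)              ∎
    where
    open ≡-Reasoning
    f f⁻ : E → ℕ
    f  b = if p b then 𝟙 r b else 0
    f⁻ b = if p b then 𝟙 (r - e) b else 0
    split : ∀ b → (if p b then 𝟙 r b else 0)
                ≡ (if p b then 𝟙 (r - e) b else 0) + (if ⌊ e ≟E b ⌋ then (if p b then 𝟙 r b else 0) else 0)
    split b with e ≟E b | p b
    ... | yes _ | true  = refl
    ... | yes _ | false = refl
    ... | no _  | true  = sym (+-identityʳ _)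
    ... | no _  | false = refl

  Out-remove : ∀ r e → r e ≡ true → ∀ v → Out v (𝟙 r) ≡ Out v (𝟙 (r - e)) + δ (src e) v
  Out-remove r e re v = ∑-remove r e re (λ b → ⌊ src b ≟V v ⌋)

  In-remove : ∀ r e → r e ≡ true → ∀ v → In v (𝟙 r) ≡ In v (𝟙 (r - e)) + δ (tgt e) v
  In-remove r e re v = ∑-remove r e re (λ b → ⌊ tgt b ≟V v ⌋)

  no-in-edges⇒In≡0 : ∀ {v} → (∀ e → tgt e ≢ v) → ∀ w → In v w ≡ 0
  no-in-edges⇒In≡0 tgt≢v w = ∑-zero edges λ e → cong (if_then w e else 0) (Vertex.≟-≢ (tgt≢v e))

  no-out-edges⇒Out≡0 : ∀ {v} → (∀ e → src e ≢ v) → ∀ w → Out v w ≡ 0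
  no-out-edges⇒Out≡0 src≢v w = ∑-zero edges λ e → cong (if_then w e else 0) (Vertex.≟-≢ (src≢v e))

  Balanced-remove : ∀ {r a b e} → Balanced r a b → r e ≡ true → src e ≡ a → Balanced (r - e) (tgt e) b
  Balanced-remove {r} {a} {b} {e} bal re refl v = +-cancelʳ-≡ (δ a v) _ _ (begin
    Out v (𝟙 (r - e)) + δ b v + δ a v ≡⟨ xy∙z≈xz∙y (Out v (𝟙 (r - e))) (δ b v) (δ a v) ⟩
    Out v (𝟙 (r - e)) + δ a v + δ b v ≡⟨ cong (_+ δ b v) (Out-remove r e re v) ⟨
    Out v (𝟙 r) + δ b v               ≡⟨ bal v ⟩
    In v (𝟙 r) + δ a v                ≡⟨ cong (_+ δ a v) (In-remove r e re v) ⟩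
    In v (𝟙 (r - e)) + δ (tgt e) v + δ a v ∎)
    where open ≡-Reasoning

  Closed⇒Balanced : ∀ {r} a → Closed r → Balanced r a a
  Closed⇒Balanced a closed v = cong (_+ δ a v) (closed v)

  Balanced⇒Closed : ∀ {r a} → Balanced r a a → Closed r
  Balanced⇒Closed {a = a} bal v = +-cancelʳ-≡ (δ a v) _ _ (bal v)

  Balanced-stuck : ∀ {r a b} → Balanced r a b → Out a (𝟙 r) ≡ 0 → a ≡ b
  Balanced-stuck {r} {a} {b} bal out≡0 with b ≟V a | bal a
  ... | yes b≡a | _   = sym b≡a
  ... | no _    | eq rewrite out≡0 | Vertex.≟-refl a = contradiction (trans eq (+-comm _ 1)) 0≢1+n

  out-edge : ∀ r v → 0 < Out v (𝟙 r) → Σ[ e ∈ E ] src e ≡ v × r e ≡ true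
  out-edge r v pos with ∑-pos edges _ pos
  ... | e , pos-e with src e ≟V v | r e in re
  ...   | yes se≡v | true  = e , se≡v , re
  ...   | yes _    | false = contradiction pos-e (<-irrefl refl)
  ...   | no _     | _     = contradiction pos-e (<-irrefl refl)

  Out-pos : ∀ r e → r e ≡ true → 0 < Out (src e) (𝟙 r)
  Out-pos r e re = subst (_≤ Out (src e) (𝟙 r)) at-e (∈⇒≤∑ _ (∈-edges e))
    where
    at-e : (if ⌊ src e ≟V src e ⌋ then 𝟙 r e else 0) ≡ 1
    at-e rewrite Vertex.≟-refl (src e) | re = refl

  In-pos : ∀ r e → r e ≡ true → 0 < In (tgt e) (𝟙 r)
  In-pos r e re = subst (_≤ In (tgt e) (𝟙 r)) at-e (∈⇒≤∑ _ (∈-edges e))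
    where
    at-e : (if ⌊ tgt e ≟V tgt e ⌋ then 𝟙 r e else 0) ≡ 1
    at-e rewrite Vertex.≟-refl (tgt e) | re = refl

  Decomposes-[] : ∀ r → Decomposes r [] r
  Decomposes-[] r e = refl

  Decomposes-∷ : ∀ {r r'} P {e} → r e ≡ true → Decomposes (r - e) P r' → Decomposes r (e ∷ P) r'
  Decomposes-∷ {r} {r'} P {e} re dec e' with e ≟E e' | dec e'
  ... | yes refl | eq rewrite ≟-refl e | re = cong suc eq
  ... | no e≢e'  | eq rewrite ≟-≢ (λ e'≡e → e≢e' (sym e'≡e)) = eq

  Decomposes-outside : ∀ {r r'} P → Decomposes r P r' → ∀ {e} → r' e ≡ false → count e P ≡ 𝟙 r e
  Decomposes-outside {r} P dec {e} r'e≡false =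
    trans (sym (+-identityʳ _)) (subst (λ b → count e P + (if b then 1 else 0) ≡ 𝟙 r e) r'e≡false (dec e))

  Decomposes-≤ : ∀ {r r'} P → Decomposes r P r' → ∀ e → 𝟙 r' e ≤ 𝟙 r e
  Decomposes-≤ P dec e = subst (_ ≤_) (dec e) (m≤n+m _ (count e P))

  Decomposes-splice : ∀ {x r r'} T₁ T₂ C → Decomposes x (T₁ ++ T₂) r → Decomposes r C r' →
                      Decomposes x (T₁ ++ C ++ T₂) r'
  Decomposes-splice {x} {r} {r'} T₁ T₂ C decT decC e = begin
    count e (T₁ ++ C ++ T₂) + 𝟙 r' e
      ≡⟨ cong (_+ 𝟙 r' e) (trans (count-++ e T₁ _) (cong (count e T₁ +_) (count-++ e C T₂))) ⟩
    count e T₁ + (count e C + count e T₂) + 𝟙 r' e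
      ≡⟨ shuffle (count e T₁) (count e C) (count e T₂) (𝟙 r' e) ⟩
    count e T₁ + count e T₂ + (count e C + 𝟙 r' e)
      ≡⟨ cong₂ _+_ (sym (count-++ e T₁ T₂)) (decC e) ⟩
    count e (T₁ ++ T₂) + 𝟙 r e
      ≡⟨ decT e ⟩
    𝟙 x e ∎
    where
    open ≡-Reasoning
    shuffle : ∀ a c b w → a + (c + b) + w ≡ a + b + (c + w)
    shuffle = solve-∀

  Decomposes⇒size< : ∀ {r r'} P {e} → Decomposes r P r' → e ∈ P → size r' < size r
  Decomposes⇒size< {r} {r'} P {e} dec e∈P =
    ∑-mono-< (Decomposes-≤ P dec) (∈-edges e) (subst (_ ≤_) (dec e) (+-monoˡ-≤ (𝟙 r' e) (∈⇒0<count e∈P)))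

  size-remove< : ∀ {r e} → r e ≡ true → size (r - e) < size r
  size-remove< {r} {e} re = Decomposes⇒size< (e ∷ []) (Decomposes-∷ [] re (Decomposes-[] (r - e))) (here refl)

  visits : V → List E → List V
  visits u []       = u ∷ []
  visits u (e ∷ es) = u ∷ visits (tgt e) es

  start∈visits : ∀ u es → u ∈ visits u es
  start∈visits u []      = here refl
  start∈visits u (_ ∷ _) = here refl

  end∈visits : ∀ {u v} es → IsWalk u es v → v ∈ visits u es
  end∈visits []       u≡v        = here (sym u≡v)
  end∈visits (e ∷ es) (_ , walk) = there (end∈visits es walk)

  endpoints∈visits : ∀ {u v e} es → IsWalk u es v → e ∈ es → src e ∈ visits u es × tgt e ∈ visits u es
  endpoints∈visits (e ∷ es) (se≡u , _) (here refl) = here se≡u , there (start∈visits _ es)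
  endpoints∈visits (e ∷ es) (_ , walk) (there e∈) =
    let s∈ , t∈ = endpoints∈visits es walk e∈ in there s∈ , there t∈

  IsWalk-++ : ∀ {u v w} P {Q} → IsWalk u P v → IsWalk v Q w → IsWalk u (P ++ Q) w
  IsWalk-++ []       refl        walkQ = walkQ
  IsWalk-++ (e ∷ P) (se , walkP) walkQ = se , IsWalk-++ P walkP walkQ

  IsWalk-split : ∀ {u v w} T → IsWalk u T v → w ∈ visits u T →
                 Σ[ T₁ ∈ List E ] Σ[ T₂ ∈ List E ] T ≡ T₁ ++ T₂ × IsWalk u T₁ w × IsWalk w T₂ v
  IsWalk-split []       u≡v         (here refl) = [] , [] , refl , refl , u≡v
  IsWalk-split (e ∷ T) walk         (here refl) = [] , e ∷ T , refl , refl , walk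
  IsWalk-split (e ∷ T) (se≡u , walk) (there w∈) =
    let T₁ , T₂ , T≡ , walk₁ , walk₂ = IsWalk-split T walk w∈
    in e ∷ T₁ , T₂ , cong (e ∷_) T≡ , (se≡u , walk₁) , walk₂

  record TrailWithRest (r : EdgeSet) (a b : V) : Set where
    constructor mkTrail
    field
      trail      : List E
      rest       : EdgeSet
      walk       : IsWalk a trail b
      closed     : Closed rest
      decomposes : Decomposes r trail rest

  open TrailWithRest

  balanced⇒trail : ∀ {r a b} → Balanced r a b → TrailWithRest r a b
  balanced⇒trail {r} bal = go (<-wellFounded (size r)) bal
    where
    go : ∀ {r a b} → Acc _<_ (size r) → Balanced r a b → TrailWithRest r a b
    go {r} {a} (acc rs) bal with Out a (𝟙 r) in out≡
    ... | zero  = let a≡b = Balanced-stuck bal out≡ in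
                  mkTrail [] r a≡b (Balanced⇒Closed (subst (Balanced r a) (sym a≡b) bal)) (Decomposes-[] r)
    ... | suc _ with out-edge r a (subst (0 <_) (sym out≡) z<s)
    ...   | e , refl , re =
      let T = go (rs (size-remove< re)) (Balanced-remove bal re refl)
      in mkTrail (e ∷ trail T) (rest T) (refl , walk T) (closed T)
                 (Decomposes-∷ (trail T) re (decomposes T))

  cycle-through : ∀ {r e} → Closed r → r e ≡ true → TrailWithRest r (src e) (src e)
  cycle-through {r} {e} closed-r re =
    let C = balanced⇒trail (Balanced-remove (Closed⇒Balanced (src e) closed-r) re refl)
    in mkTrail (e ∷ trail C) (rest C) (refl , walk C) (closed C) (Decomposes-∷ (trail C) re (decomposes C))

  splice : ∀ {x a b w} (T : TrailWithRest x a b) → w ∈ visits a (trail T) →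
           TrailWithRest (rest T) w w → TrailWithRest x a b
  splice T w∈ C =
    let T₁ , T₂ , T≡ , walk₁ , walk₂ = IsWalk-split (trail T) (walk T) w∈
    in mkTrail (T₁ ++ trail C ++ T₂) (rest C)
               (IsWalk-++ T₁ walk₁ (IsWalk-++ (trail C) (walk C) walk₂)) (closed C)
               (Decomposes-splice T₁ T₂ (trail C)
                 (subst (λ P → Decomposes _ P (rest T)) T≡ (decomposes T)) (decomposes C))

  Stuck : ∀ {x a b} → TrailWithRest x a b → Set
  Stuck {a = a} T = ∀ v → v ∈ visits a (trail T) → Out v (𝟙 (rest T)) ≡ 0

  maximal-trail : ∀ {x a b} → TrailWithRest x a b → Σ[ T ∈ TrailWithRest x a b ] Stuck T
  maximal-trail T = go T (<-wellFounded (size (rest T)))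
    where
    go : ∀ {x a b} (T : TrailWithRest x a b) → Acc _<_ (size (rest T)) → Σ[ T ∈ TrailWithRest x a b ] Stuck T
    go {a = a} T (acc rs) with any? (λ v → 0 <? Out v (𝟙 (rest T))) (visits a (trail T))
    ... | no none = T , λ v v∈ → n≤0⇒n≡0 (≮⇒≥ (All.lookup (¬Any⇒All¬ _ none) v∈))
    ... | yes some with find some
    ...   | w , w∈ , pos with out-edge (rest T) w pos
    ...     | e , refl , re =
      let C = cycle-through (closed T) re
      in go (splice T w∈ C) (rs (Decomposes⇒size< (trail C) (decomposes C) (here refl)))

  ∑-group-by-endpoint : ∀ (g : E → V) (π : V → ℕ) (w : E → ℕ) →
             ∑[ v ← vertices ] (π v * ∑[ e ← edges ] (if ⌊ g e ≟V v ⌋ then w e else 0))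
             ≡ ∑[ e ← edges ] (π (g e) * w e)
  ∑-group-by-endpoint g π w = begin
    ∑[ v ← vertices ] (π v * ∑[ e ← edges ] (if ⌊ g e ≟V v ⌋ then w e else 0))
      ≡⟨ ∑-cong vertices (λ v → ∑-*ˡ edges (π v) _) ⟨
    ∑[ v ← vertices ] ∑[ e ← edges ] (π v * (if ⌊ g e ≟V v ⌋ then w e else 0))
      ≡⟨ ∑-comm vertices edges _ ⟩
    ∑[ e ← edges ] ∑[ v ← vertices ] (π v * (if ⌊ g e ≟V v ⌋ then w e else 0))
      ≡⟨ ∑-cong edges (λ e → ∑-cong vertices (λ v → *-if (π v) ⌊ g e ≟V v ⌋)) ⟩
    ∑[ e ← edges ] ∑[ v ← vertices ] (if ⌊ g e ≟V v ⌋ then π v * w e else 0)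
      ≡⟨ ∑-cong edges (λ e → Vertex.∑-sift vertices (g e) (λ v → π v * w e)) ⟩
    ∑[ e ← edges ] (Vertex.count (g e) vertices * (π (g e) * w e))
      ≡⟨ ∑-cong edges (λ e → trans (cong (_* _) (vertices-enum (g e))) (*-identityˡ _)) ⟩
    ∑[ e ← edges ] (π (g e) * w e) ∎
    where
    open ≡-Reasoning
    *-if : ∀ m b {n} → m * (if b then n else 0) ≡ (if b then m * n else 0)
    *-if m true  = refl
    *-if m false = *-zeroʳ m

  weighted-flow : ∀ {x d} (π : V → ℕ) → (∀ v → π v * Out v d ≡ π v * (In v d + Out v (𝟙 x))) →
                  ∑[ e ← edges ] (π (src e) * d e)
                  ≡ ∑[ e ← edges ] (π (tgt e) * d e) + ∑[ e ← edges ] (π (src e) * 𝟙 x e)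
  weighted-flow {x} {d} π flow = begin
    ∑[ e ← edges ] (π (src e) * d e)                         ≡⟨ ∑-group-by-endpoint src π d ⟨
    ∑[ v ← vertices ] (π v * Out v d)                        ≡⟨ ∑-cong vertices flow ⟩
    ∑[ v ← vertices ] (π v * (In v d + Out v (𝟙 x)))      ≡⟨ ∑-cong vertices (λ v → *-distribˡ-+ (π v) _ _) ⟩
    ∑[ v ← vertices ] (π v * In v d + π v * Out v (𝟙 x))  ≡⟨ ∑-+ vertices _ _ ⟩
    ∑[ v ← vertices ] (π v * In v d) + ∑[ v ← vertices ] (π v * Out v (𝟙 x))
      ≡⟨ cong₂ _+_ (∑-group-by-endpoint tgt π d) (∑-group-by-endpoint src π (𝟙 x)) ⟩
    ∑[ e ← edges ] (π (tgt e) * d e) + ∑[ e ← edges ] (π (src e) * 𝟙 x e) ∎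
    where open ≡-Reasoning

  module Potential {x : EdgeSet} {d : E → ℕ} {a b : V} (T : TrailWithRest x a b) (stuck : Stuck T)
           (d-support : ∀ e → x e ≡ false → d e ≡ 0)
           (flow : ∀ v → v ≢ a → v ≢ b → Out v d ≡ In v d + Out v (𝟙 x)) where

    open import Data.List.Membership.DecPropositional _≟V_ using (_∈?_)

    on-trail : V → Set
    on-trail v = v ∈ visits a (trail T)

    off : V → ℕ
    off v = if ⌊ v ∈? visits a (trail T) ⌋ then 0 else 1

    off-on : ∀ {v} → on-trail v → off v ≡ 0
    off-on {v} v∈ with v ∈? visits a (trail T)
    ... | yes _ = refl
    ... | no v∉ = contradiction v∈ v∉

    off-off : ∀ {v} → ¬ on-trail v → off v ≡ 1
    off-off {v} v∉ with v ∈? visits a (trail T)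
    ... | yes v∈ = contradiction v∈ v∉
    ... | no _   = refl

    src-rest-off : ∀ {e} → rest T e ≡ true → ¬ on-trail (src e)
    src-rest-off {e} re se∈ = <-irrefl (sym (stuck _ se∈)) (Out-pos (rest T) e re)

    tgt-rest-off : ∀ {e} → rest T e ≡ true → ¬ on-trail (tgt e)
    tgt-rest-off {e} re te∈ =
      <-irrefl (sym (trans (sym (closed T (tgt e))) (stuck _ te∈))) (In-pos (rest T) e re)

    x-not-rest⇒on-trail : ∀ {e} → x e ≡ true → rest T e ≡ false → e ∈ trail T
    x-not-rest⇒on-trail {e} xe re = 0<count⇒∈ (trail T) (subst (0 <_) (sym count≡1) z<s)
      where
      count≡1 : count e (trail T) ≡ 1
      count≡1 = trans (Decomposes-outside (trail T) (decomposes T) re) (𝟙≡1 x xe)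

    off-conserved : ∀ e → off (src e) * d e ≡ off (tgt e) * d e
    off-conserved e with x e in xe | rest T e in re
    ... | false | _     rewrite d-support e xe = trans (*-zeroʳ (off (src e))) (sym (*-zeroʳ (off (tgt e))))
    ... | true  | true  rewrite off-off (src-rest-off re) | off-off (tgt-rest-off re) = refl
    ... | true  | false =
      let se∈ , te∈ = endpoints∈visits (trail T) (walk T) (x-not-rest⇒on-trail xe re)
      in cong (_* d e) (trans (off-on se∈) (sym (off-on te∈)))

    off-flow : ∀ v → off v * Out v d ≡ off v * (In v d + Out v (𝟙 x))
    off-flow v with v ≟V a | v ≟V b
    ... | yes refl | _        rewrite off-on (start∈visits a (trail T)) = refl
    ... | no _     | yes refl rewrite off-on (end∈visits (trail T) (walk T)) = refl
    ... | no v≢a   | no v≢b   = cong (off v *_) (flow v v≢a v≢b)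

    rest⊆x : ∀ {e} → rest T e ≡ true → x e ≡ true
    rest⊆x {e} re with x e | Decomposes-≤ (trail T) (decomposes T) e
    ... | true  | _ = refl
    ... | false | 1≤0 rewrite re = contradiction 1≤0 λ ()

    off-x≡0 : ∑[ e ← edges ] (off (src e) * 𝟙 x e) ≡ 0
    off-x≡0 = +-cancelˡ-≡ (∑[ e ← edges ] (off (tgt e) * d e)) _ 0 (begin
      ∑[ e ← edges ] (off (tgt e) * d e) + ∑[ e ← edges ] (off (src e) * 𝟙 x e) ≡⟨ weighted-flow off off-flow ⟨
      ∑[ e ← edges ] (off (src e) * d e)                                       ≡⟨ ∑-cong edges off-conserved ⟩
      ∑[ e ← edges ] (off (tgt e) * d e)                                       ≡⟨ +-identityʳ _ ⟨
      ∑[ e ← edges ] (off (tgt e) * d e) + 0                                   ∎)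
      where open ≡-Reasoning

    rest-empty : ∀ e → rest T e ≡ false
    rest-empty e with rest T e in re
    ... | false = refl
    ... | true  = contradiction (subst (1 ≤_) off-x≡0 (≤-trans one≤ (∈⇒≤∑ _ (∈-edges e)))) λ ()
      where
      one≤ : 1 ≤ off (src e) * 𝟙 x e
      one≤ rewrite off-off (src-rest-off re) | rest⊆x re = ≤-refl

  flow⇒eulerian-trail : ∀ {x : EdgeSet} {d : E → ℕ} {a b} → Balanced x a b →
                         (∀ e → x e ≡ false → d e ≡ 0) →
                         (∀ v → v ≢ a → v ≢ b → Out v d ≡ In v d + Out v (𝟙 x)) →
                         Σ[ es ∈ List E ] IsWalk a es b × (∀ e → count e es ≡ 𝟙 x e)
  flow⇒eulerian-trail bal d-support flow =
    let T , stuck = maximal-trail (balanced⇒trail bal)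
    in trail T , walk T ,
       λ e → Decomposes-outside (trail T) (decomposes T) (Potential.rest-empty T stuck d-support flow e)

  count≡𝟙⇒covering : ∀ {x} es → (∀ e → count e es ≡ 𝟙 x e) → Unique es × (∀ e → (e ∈ es) ⇔ (x e ≡ true))
  count≡𝟙⇒covering {x} es count≡ = count≤1⇒unique es count≤1 , λ e → mk⇔ (∈⇒x e) (x⇒∈ e)
    where
    count≤1 : ∀ e → count e es ≤ 1
    count≤1 e rewrite count≡ e with x e
    ... | true  = ≤-refl
    ... | false = z≤n
    ∈⇒x : ∀ e → e ∈ es → x e ≡ true
    ∈⇒x e e∈ with x e | subst (0 <_) (count≡ e) (∈⇒0<count e∈)
    ... | true | _ = refl
    x⇒∈ : ∀ e → x e ≡ true → e ∈ es
    x⇒∈ e xe = 0<count⇒∈ es (subst (0 <_) (sym (trans (count≡ e) (𝟙≡1 x xe))) z<s)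

  UReach-trans : ∀ {P u v w} → UReach P u v → UReach P v w → UReach P u w
  UReach-trans here          q = q
  UReach-trans (fwd Pe p) q = fwd Pe (UReach-trans p q)
  UReach-trans (bwd Pe p) q = bwd Pe (UReach-trans p q)

  UReach-sym : ∀ {P u v} → UReach P u v → UReach P v u
  UReach-sym here       = here
  UReach-sym (fwd Pe p) = UReach-trans (UReach-sym p) (bwd Pe here)
  UReach-sym (bwd Pe p) = UReach-trans (UReach-sym p) (fwd Pe here)

  walk⇒UReach : ∀ {P : E → Set} {u v w} T → IsWalk u T v → (∀ e → e ∈ T → P e) →
                w ∈ visits u T → UReach P u w
  walk⇒UReach []       _           _   (here refl)  = here
  walk⇒UReach (e ∷ T) _           _   (here refl)  = here
  walk⇒UReach (e ∷ T) (refl , walkT) P-T (there w∈) =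
    fwd (P-T e (here refl)) (walk⇒UReach T walkT (λ e' e'∈ → P-T e' (there e'∈)) w∈)

  Touches : EdgeSet → V → Set
  Touches x v = Σ[ e ∈ E ] (x e ≡ true) × ((src e ≡ v) ⊎ (tgt e ≡ v))

  covering-trail⇒connected : ∀ {x a b es} → IsCoveringTrail (λ e → x e ≡ true) a es b →
                              ∀ u v → Touches x u → Touches x v → UReach (λ e → x e ≡ true) u v
  covering-trail⇒connected {x} {a} {b} {es} (walk-es , _ , covers) u v touches-u touches-v =
    UReach-trans (UReach-sym (reach touches-u)) (reach touches-v)
    where
    visited : ∀ {w} → Touches x w → w ∈ visits a es
    visited (e , xe , inj₁ refl) = proj₁ (endpoints∈visits es walk-es (Equivalence.from (covers e) xe))
    visited (e , xe , inj₂ refl) = proj₂ (endpoints∈visits es walk-es (Equivalence.from (covers e) xe))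
    reach : ∀ {w} → Touches x w → UReach (λ e → x e ≡ true) a w
    reach touches = walk⇒UReach es walk-es (λ e → Equivalence.to (covers e)) (visited touches)

concatMap-map≡cartesianProductWith : ∀ {A B C : Set} (f : A → B → C) xs ys →
                                     concatMap (λ x → map (f x) ys) xs ≡ cartesianProductWith f xs ys
concatMap-map≡cartesianProductWith f []       ys = refl
concatMap-map≡cartesianProductWith f (x ∷ xs) ys =
  cong (map (f x) ys ++_) (concatMap-map≡cartesianProductWith f xs ys)

module _ {C : Set} where

  ∉-++ : ∀ {v : C} xs {ys} → v ∉ xs → v ∉ ys → v ∉ xs ++ ys
  ∉-++ xs v∉xs v∉ys v∈ = [ v∉xs , v∉ys ] (∈-++⁻ xs v∈)

  ∉-map : ∀ {A : Set} {v : C} {f : A → C} xs → (∀ a → v ≢ f a) → v ∉ map f xs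
  ∉-map {f = f} xs v≢ v∈ = let a , _ , v≡ = ∈-map⁻ f v∈ in v≢ a v≡

  ∉-cartesianProductWith : ∀ {A B : Set} {v : C} {f : A → B → C} xs ys → (∀ a b → v ≢ f a b) →
                           v ∉ cartesianProductWith f xs ys
  ∉-cartesianProductWith {f = f} xs ys v≢ v∈ =
    let a , b , _ , _ , v≡ = ∈-cartesianProductWith⁻ f xs ys v∈ in v≢ a b v≡

  map-disjoint : ∀ {A : Set} {zs : List C} {f : A → C} xs → (∀ a → f a ∉ zs) → Disjoint (map f xs) zs
  map-disjoint {f = f} xs f∉ (v∈ , v∈zs) with ∈-map⁻ f v∈
  ... | a , _ , refl = f∉ a v∈zs

  cartesianProductWith-disjoint : ∀ {A B : Set} {zs : List C} {f : A → B → C} xs ys →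
                                  (∀ a b → f a b ∉ zs) → Disjoint (cartesianProductWith f xs ys) zs
  cartesianProductWith-disjoint {f = f} xs ys f∉ (v∈ , v∈zs) with ∈-cartesianProductWith⁻ f xs ys v∈
  ... | a , b , _ , _ , refl = f∉ a b v∈zs

module AlignmentGraph {L : Set} {G₁ G₂ : Graph L} (c : Config G₁ G₂) where

  open Graph

  Code : Set
  Code = (Fin (nE G₁) × Fin (nV G₂)) ⊎ (Fin (nV G₁) × Fin (nE G₂)) ⊎ (Fin (nE G₁) × Fin (nE G₂))
         ⊎ Fin (length (sHeads c)) ⊎ Fin (length (tTails c))

  encode : AEdge c → Code
  encode (vert f u)  = inj₁ (f , u)
  encode (horiz u g) = inj₂ (inj₁ (u , g))
  encode (diag f g)  = inj₂ (inj₂ (inj₁ (f , g)))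
  encode (sEdge i)   = inj₂ (inj₂ (inj₂ (inj₁ i)))
  encode (tEdge i)   = inj₂ (inj₂ (inj₂ (inj₂ i)))

  decode : Code → AEdge c
  decode (inj₁ (f , u))                      = vert f u
  decode (inj₂ (inj₁ (u , g)))               = horiz u g
  decode (inj₂ (inj₂ (inj₁ (f , g))))        = diag f g
  decode (inj₂ (inj₂ (inj₂ (inj₁ i))))       = sEdge i
  decode (inj₂ (inj₂ (inj₂ (inj₂ i))))       = tEdge i

  decode-encode : ∀ e → decode (encode e) ≡ e
  decode-encode (vert _ _)  = refl
  decode-encode (horiz _ _) = refl
  decode-encode (diag _ _)  = refl
  decode-encode (sEdge _)   = refl
  decode-encode (tEdge _)   = refl

  encode-injective : ∀ {e e'} → encode e ≡ encode e' → e ≡ e'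
  encode-injective {e} {e'} eq = trans (sym (decode-encode e)) (trans (cong decode eq) (decode-encode e'))

  _≟E_ : DecidableEquality (AEdge c)
  e ≟E e' = map′ encode-injective (cong encode) (encode e ≟C encode e')
    where
    _≟C_ : DecidableEquality Code
    _≟C_ = Sum.≡-dec (Product.≡-dec Fin._≟_ Fin._≟_) (Sum.≡-dec (Product.≡-dec Fin._≟_ Fin._≟_)
             (Sum.≡-dec (Product.≡-dec Fin._≟_ Fin._≟_) (Sum.≡-dec Fin._≟_ Fin._≟_)))

  V₁s V₂s E₁s E₂s Ss Ts : List _
  V₁s = allFin (nV G₁)
  V₂s = allFin (nV G₂)
  E₁s = allFin (nE G₁)
  E₂s = allFin (nE G₂)
  Ss  = allFin (length (sHeads c))
  Ts  = allFin (length (tTails c))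

  verts horizs diags sources sinks : List (AEdge c)
  verts   = cartesianProductWith vert E₁s V₂s
  horizs  = cartesianProductWith horiz V₁s E₂s
  diags   = cartesianProductWith diag E₁s E₂s
  sources = map sEdge Ss
  sinks   = map tEdge Ts

  allEdges≡blocks : allEdges ≡ verts ++ horizs ++ diags ++ sources ++ sinks
  allEdges≡blocks = cong₂ _++_ (concatMap-map≡cartesianProductWith vert E₁s V₂s)
                      (cong₂ _++_ (concatMap-map≡cartesianProductWith horiz V₁s E₂s)
                        (cong (_++ sources ++ sinks) (concatMap-map≡cartesianProductWith diag E₁s E₂s)))

  verts-unique : Unique verts
  verts-unique = cartesianProductWith⁺ vert (λ { refl → refl , refl }) (allFin⁺ _) (allFin⁺ _)

  horizs-unique : Unique horizs
  horizs-unique = cartesianProductWith⁺ horiz (λ { refl → refl , refl }) (allFin⁺ _) (allFin⁺ _)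

  diags-unique : Unique diags
  diags-unique = cartesianProductWith⁺ diag (λ { refl → refl , refl }) (allFin⁺ _) (allFin⁺ _)

  sources-unique : Unique sources
  sources-unique = map⁺ (λ { refl → refl }) (allFin⁺ _)

  sinks-unique : Unique sinks
  sinks-unique = map⁺ (λ { refl → refl }) (allFin⁺ _)

  blocks-unique : Unique (verts ++ horizs ++ diags ++ sources ++ sinks)
  blocks-unique =
    ++⁺ verts-unique (++⁺ horizs-unique (++⁺ diags-unique (++⁺ sources-unique sinks-unique
      (map-disjoint Ss λ _ → ∉-map Ts λ _ ()))
      (cartesianProductWith-disjoint E₁s E₂s λ _ _ → ∉-sources++sinks (λ ()) (λ ())))
      (cartesianProductWith-disjoint V₁s E₂s λ _ _ → ∉-diags++ (λ ()) (λ ()) (λ ())))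
      (cartesianProductWith-disjoint E₁s V₂s λ _ _ →
        ∉-++ horizs (∉-cartesianProductWith V₁s E₂s λ _ _ ()) (∉-diags++ (λ ()) (λ ()) (λ ())))
    where
    ∉-sources++sinks : ∀ {e} → (∀ {i} → e ≢ sEdge i) → (∀ {i} → e ≢ tEdge i) → e ∉ sources ++ sinks
    ∉-sources++sinks e≢s e≢t = ∉-++ sources (∉-map Ss λ _ → e≢s) (∉-map Ts λ _ → e≢t)
    ∉-diags++ : ∀ {e} → (∀ {f g} → e ≢ diag f g) → (∀ {i} → e ≢ sEdge i) → (∀ {i} → e ≢ tEdge i) →
                e ∉ diags ++ sources ++ sinks
    ∉-diags++ e≢d e≢s e≢t = ∉-++ diags (∉-cartesianProductWith E₁s E₂s λ _ _ → e≢d) (∉-sources++sinks e≢s e≢t)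

  ∈-blocks : ∀ e → e ∈ verts ++ horizs ++ diags ++ sources ++ sinks
  ∈-blocks (vert f u)  = ∈-++⁺ˡ (∈-cartesianProductWith⁺ vert (∈-allFin f) (∈-allFin u))
  ∈-blocks (horiz u g) = ∈-++⁺ʳ verts (∈-++⁺ˡ (∈-cartesianProductWith⁺ horiz (∈-allFin u) (∈-allFin g)))
  ∈-blocks (diag f g)  = ∈-++⁺ʳ verts (∈-++⁺ʳ horizs (∈-++⁺ˡ (∈-cartesianProductWith⁺ diag (∈-allFin f) (∈-allFin g))))
  ∈-blocks (sEdge i)   = ∈-++⁺ʳ verts (∈-++⁺ʳ horizs (∈-++⁺ʳ diags (∈-++⁺ˡ (∈-map⁺ sEdge (∈-allFin i)))))
  ∈-blocks (tEdge i)   = ∈-++⁺ʳ verts (∈-++⁺ʳ horizs (∈-++⁺ʳ diags (∈-++⁺ʳ sources (∈-map⁺ tEdge (∈-allFin i)))))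

  allEdges-enum : Counting.IsEnumeration _≟E_ allEdges
  allEdges-enum e rewrite allEdges≡blocks = Counting.unique⇒count≡1 _≟E_ blocks-unique (∈-blocks e)

  grid : List (AVertex {L} {G₁} {G₂})
  grid = cartesianProductWith ⟨_,_⟩ V₁s V₂s

  allVertices : List (AVertex {L} {G₁} {G₂})
  allVertices = s ∷ t ∷ grid

  allVertices-unique : Unique allVertices
  allVertices-unique =
    All.tabulate (λ { (here refl) () ; (there v∈) refl → ∉-cartesianProductWith V₁s V₂s (λ _ _ ()) v∈ })
    ∷ All.tabulate (λ { v∈ refl → ∉-cartesianProductWith V₁s V₂s (λ _ _ ()) v∈ })
    ∷ cartesianProductWith⁺ ⟨_,_⟩ (λ { refl → refl , refl }) (allFin⁺ _) (allFin⁺ _)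

  ∈-allVertices : ∀ v → v ∈ allVertices
  ∈-allVertices s         = here refl
  ∈-allVertices t         = there (here refl)
  ∈-allVertices ⟨ a , b ⟩ = there (there (∈-cartesianProductWith⁺ ⟨_,_⟩ (∈-allFin a) (∈-allFin b)))

  allVertices-enum : Counting.IsEnumeration _≟V_ allVertices
  allVertices-enum v = Counting.unique⇒count≡1 _≟V_ allVertices-unique (∈-allVertices v)

  open Trails _≟V_ _≟E_ aSrc aTgt allVertices allEdges allVertices-enum allEdges-enum public

  In-s≡0 : ∀ w → In s w ≡ 0
  In-s≡0 = no-in-edges⇒In≡0 λ { (vert _ _) () ; (horiz _ _) () ; (diag _ _) () ; (sEdge _) () ; (tEdge _) () }

  Out-t≡0 : ∀ w → Out t w ≡ 0
  Out-t≡0 = no-out-edges⇒Out≡0 λ { (vert _ _) () ; (horiz _ _) () ; (diag _ _) () ; (sEdge _) () ; (tEdge _) () }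

  balanced : ∀ {x} → Cond-ii x → Cond-iii x → Balanced x s t
  balanced {x} (out-s≡1 , _) _ s = trans (cong (_+ 0) out-s≡1) (cong (_+ 1) (sym (In-s≡0 (𝟙 x))))
  balanced {x} (_ , in-t≡1) _ t = trans (cong (_+ 1) (Out-t≡0 (𝟙 x))) (cong (_+ 0) (sym in-t≡1))
  balanced _ conserved ⟨ a , b ⟩ = cong (_+ 0) (sym (conserved a b))

  inner-flow : ∀ {x d} → Cond-v x d → ∀ v → v ≢ s → v ≢ t → Out v d ≡ In v d + Out v (𝟙 x)
  inner-flow _    s         s≢s _ = contradiction refl s≢s
  inner-flow _    t         _ t≢t = contradiction refl t≢t
  inner-flow flow ⟨ a , b ⟩ _ _   = flow a b

lemma2 : ∀ {L : Set} (G₁ G₂ : Graph L) → IsUEGraph G₁ → IsUEGraph G₂ →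
           (c : Config G₁ G₂) (x : AEdge c → Bool) (d : AEdge c → ℕ) →
           Cond-i x → Cond-ii x → Cond-iii x → Cond-iv x d → Cond-v x d → Cond-vi x d →
           G'Connected x × G'EulerST x
lemma2 G₁ G₂ _ _ c x d _ one-in-one-out conserved d-support flow _ =
  let es , walk-es , count≡ =
        flow⇒eulerian-trail (balanced one-in-one-out conserved) d-support (inner-flow flow)
      covering = walk-es , count≡𝟙⇒covering es count≡
  in covering-trail⇒connected covering , es , covering
  where open AlignmentGraph c
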